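{- Let $k\ge4$, $V=[k]\times[k]$, and let $f:2^V\to\mathbb{R}_{\ge0}$ be given by $f(S)=\sum_{i=1}^k\big(g(R_i\cap S)+g(C_i\cap S)\big)$, where $R_i=\{(i,j):j\in[k]\}$, $C_i=\{(j,i):j\in[k]\}$, $g(S)=\phi_t(|S|)$ if $S$ contains some $(\ell,\ell)$ and $g(S)=\phi_n(|S|)$ otherwise, with $\phi_n(a)=\min\{a,\frac78k\}$ and $\phi_t(a)=\min\{\frac38ka,\frac38k+a-1,\frac78k\}$. Let $Q_1,\dots,Q_k$ be a symmetric multiway partition of $V$. Then $\sum_{\ell=1}^k f(Q_\ell)\ge\frac{10k^2-14k-1}{4}$.
   Context: For $A\subseteq V$, $A^T=\{(j,i):(i,j)\in A\}$. A symmetric multiway partition of $V$ is a partition $Q_1,\dots,Q_k$ of $V$ with $Q_\ell=Q_\ell^T$ and $(\ell,\ell)\in Q_\ell$ for every $\ell\in[k]$. -}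

module Defs where

open import Data.Nat using (ℕ; zero; suc)
import Data.Nat as ℕ
open import Data.Integer using (+_)
open import Data.Fin using (Fin; zero; suc)
open import Data.Bool using (Bool; true; false; if_then_else_; _∧_; _∨_)
open import Data.Product using (_×_; _,_)
open import Data.Rational using (ℚ; 0ℚ; 1ℚ; _+_; _-_; _*_; _⊓_; _/_)
open import Relation.Binary.PropositionalEquality using (_≡_)
open import Relation.Nullary.Decidable using (⌊_⌋)
open import Data.Fin using (_≟_)

Cell : ℕ → Set
Cell k = Fin k × Fin k

Sub : ℕ → Set
Sub k = Cell k → Bool

Σℚ : (n : ℕ) → (Fin n → ℚ) → ℚ
Σℚ zero    f = 0ℚ
Σℚ (suc n) f = f zero + Σℚ n (λ i → f (suc i))

Σℕ : (n : ℕ) → (Fin n → ℕ) → ℕ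
Σℕ zero    f = 0
Σℕ (suc n) f = f zero ℕ.+ Σℕ n (λ i → f (suc i))

anyFin : (n : ℕ) → (Fin n → Bool) → Bool
anyFin zero    f = false
anyFin (suc n) f = f zero ∨ anyFin n (λ i → f (suc i))

card : {k : ℕ} → Sub k → ℕ
card {k} S = Σℕ k (λ i → Σℕ k (λ j → if S (i , j) then 1 else 0))

_∩_ : {k : ℕ} → Sub k → Sub k → Sub k
(A ∩ B) v = A v ∧ B v

Row : {k : ℕ} → Fin k → Sub k
Row i (a , b) = ⌊ a ≟ i ⌋

Col : {k : ℕ} → Fin k → Sub k
Col i (a , b) = ⌊ b ≟ i ⌋

hasDiag : {k : ℕ} → Sub k → Bool
hasDiag {k} S = anyFin k (λ ℓ → S (ℓ , ℓ))

ℕtoℚ : ℕ → ℚ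
ℕtoℚ n = + n / 1

φn : ℕ → ℕ → ℚ
φn k a = ℕtoℚ a ⊓ ((+ 7 / 8) * ℕtoℚ k)

φt : ℕ → ℕ → ℚ
φt k a = ((+ 3 / 8) * ℕtoℚ k * ℕtoℚ a)
       ⊓ ((+ 3 / 8) * ℕtoℚ k + ℕtoℚ a - 1ℚ)
       ⊓ ((+ 7 / 8) * ℕtoℚ k)

g : {k : ℕ} → Sub k → ℚ
g {k} S = if hasDiag S then φt k (card S) else φn k (card S)

f : {k : ℕ} → Sub k → ℚ
f {k} S = Σℚ k (λ i → g (Row i ∩ S) + g (Col i ∩ S))

-- A symmetric multiway partition Q_1..Q_k of V, represented by the labelling
-- c : V → [k] with Q_ℓ = { v | c v = ℓ }.  (Labelling ⇔ indexed partition.)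
Part : {k : ℕ} → (Cell k → Fin k) → Fin k → Sub k
Part c ℓ v = ⌊ c v ≟ ℓ ⌋

IsSymMultiwayPartition : {k : ℕ} → (Cell k → Fin k) → Set
IsSymMultiwayPartition {k} c =
  ((i j : Fin k) → c (i , j) ≡ c (j , i)) × ((ℓ : Fin k) → c (ℓ , ℓ) ≡ ℓ)

module Submission where

-- Write a j ℓ = |R_j ∩ Q_ℓ|; by symmetry this is also |C_j ∩ Q_ℓ|, and since (j , j) ∈ Q_j
-- both sets meet the diagonal exactly when ℓ = j.  So ∑_ℓ f(Q_ℓ) = (2/8) ∑_j R_j, where the
-- integer R_j is 8φt(a j j) + ∑_{ℓ ≠ j} 8φn(a j ℓ).  Call row j top when a j j > k/2 + 1.
-- A top row has R_j + 8 a j j = 15k.  A non-top row has R_j + 8 = 11k, unless some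
-- a j ℓ ≥ 7k/8, and then R_j + 8 + 8 a j ℓ = 18k.  Let t_j count the top i with (j , i) ∈ Q_i,
-- and m, r = k − m the numbers of top and non-top rows.  By symmetry ∑_j t_j = ∑_{top i} a i i,
-- the top rows j contribute at most m(m+1)/2 to it, and t_j + a j ℓ ≤ k for a non-top row j
-- and ℓ ≠ j; hence 11k + 8t_j ≤ R_j + 8 + max(8m, k) for non-top rows.  Summing all row bounds,
-- the terms 8 a j j of the top rows cancel against 8 ∑_j t_j, leaving
-- 11k² + 4km ≤ ∑_j R_j + r(max(8m, k) + 8) + 4m(m+1), which forces ∑_j R_j ≥ 10k² − 14k − 1.

open import Defs
open import Data.Bool using (Bool; true; false; if_then_else_; _∧_; _∨_; not)
open import Data.Bool.Properties using (∨-identityʳ)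
open import Data.Fin using (Fin; zero; suc; _≟_)
open import Data.Fin.Properties as Fin using (any?)
import Data.Nat as ℕ
open import Data.Nat using (ℕ; zero; suc; _+_; _*_; _∸_; _≤_; _<_; _⊓_; _⊔_; z≤n; s≤s; _<?_)
open import Data.Nat.Properties hiding (_≟_)
open import Data.Nat.Tactic.RingSolver using (solve-∀)
open import Data.Product using (_,_)
open import Data.Sum using (inj₁; inj₂; [_,_]′)
open import Function using (_∘_)
open import Relation.Binary.PropositionalEquality
open import Relation.Nullary using (¬_; Dec; yes; no)
open import Relation.Nullary.Decidable using (⌊_⌋; isYes≗does; dec-true; dec-false)
open import Data.Integer as ℤ using (ℤ; +_; _-_; +≤+)
import Data.Integer.Properties as ℤ
import Data.Integer.Tactic.RingSolver as ℤ-Solver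
open import Data.Rational as ℚ using (ℚ; _/_; 1ℚ; toℚᵘ)
import Data.Rational.Properties as ℚ
open import Data.Rational.Unnormalised as ℚᵘ using (mkℚᵘ; *≡*; *≤*) renaming (_≃_ to _≃ᵘ_)
import Data.Rational.Unnormalised.Properties as ℚᵘ
open import Algebra.Properties.CommutativeSemigroup +-commutativeSemigroup
  using (xy∙z≈zy∙x; xy∙z≈xz∙y; x∙yz≈yx∙z)
open import Algebra.Properties.Semiring.Sum +-*-semiring
  using (sum; sum-syntax; sum-cong-≗; ∑-comm; ∑-distrib-+; *-distribˡ-sum; *-distribʳ-sum)

Σℕ≡sum : ∀ n (f : Fin n → ℕ) → Σℕ n f ≡ sum f
Σℕ≡sum zero    f = refl
Σℕ≡sum (suc n) f = cong (_+_ (f zero)) (Σℕ≡sum n (f ∘ suc))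

sum-mono-≤ : ∀ {n} {f g : Fin n → ℕ} → (∀ i → f i ≤ g i) → sum f ≤ sum g
sum-mono-≤ {zero}  f≤g = z≤n
sum-mono-≤ {suc n} f≤g = +-mono-≤ (f≤g zero) (sum-mono-≤ (f≤g ∘ suc))

sum-const : ∀ n x → ∑[ i < n ] x ≡ n * x
sum-const zero    x = refl
sum-const (suc n) x = cong (_+_ x) (sum-const n x)

∑-distrib-+₃ : ∀ {n} (f g h : Fin n → ℕ) → ∑[ i < n ] (f i + g i + h i) ≡ sum f + sum g + sum h
∑-distrib-+₃ f g h = trans (∑-distrib-+ (λ i → f i + g i) h) (cong (_+ sum h) (∑-distrib-+ f g))

∑-1 : ∀ n → ∑[ i < n ] 1 ≡ n
∑-1 n = trans (sum-const n 1) (*-identityʳ n)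

term≤sum : ∀ {n} (f : Fin n → ℕ) (x : Fin n) → f x ≤ sum f
term≤sum f zero    = m≤m+n (f zero) _
term≤sum f (suc x) = ≤-trans (term≤sum (f ∘ suc) x) (m≤n+m _ (f zero))

sum-update : ∀ {n} {f g : Fin n → ℕ} (x : Fin n) →
             (∀ i → ¬ i ≡ x → f i ≡ g i) → sum f + g x ≡ sum g + f x
sum-update {suc n} {f} {g} zero f≗g
  rewrite sum-cong-≗ (λ i → f≗g (suc i) λ ()) = xy∙z≈zy∙x (f zero) (sum (g ∘ suc)) (g zero)
sum-update {suc n} {f} {g} (suc x) f≗g
  rewrite f≗g zero (λ ())
  = trans (+-assoc (g zero) _ _)
          (trans (cong (_+_ (g zero)) (sum-update x (λ i i≢x → f≗g (suc i) (i≢x ∘ Fin.suc-injective))))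
                 (sym (+-assoc (g zero) _ _)))

𝟙 : Bool → ℕ
𝟙 b = if b then 1 else 0

𝟙≤1 : ∀ b → 𝟙 b ≤ 1
𝟙≤1 true  = ≤-refl
𝟙≤1 false = z≤n

𝟙-∧ : ∀ b b′ → 𝟙 (b ∧ b′) ≡ 𝟙 b * 𝟙 b′
𝟙-∧ true  b′ = sym (+-identityʳ (𝟙 b′))
𝟙-∧ false b′ = refl

𝟙-+-𝟙-not : ∀ b → 𝟙 b + 𝟙 (not b) ≡ 1
𝟙-+-𝟙-not true  = refl
𝟙-+-𝟙-not false = refl

⌊⌋-true : ∀ {p} {P : Set p} (d : Dec P) → P → ⌊ d ⌋ ≡ true
⌊⌋-true d p = trans (isYes≗does d) (dec-true d p)

⌊⌋-false : ∀ {p} {P : Set p} (d : Dec P) → ¬ P → ⌊ d ⌋ ≡ false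
⌊⌋-false d ¬p = trans (isYes≗does d) (dec-false d ¬p)

δ : ∀ {n} → Fin n → Fin n → ℕ
δ x y = 𝟙 ⌊ x ≟ y ⌋

δ-refl : ∀ {n} (x : Fin n) → δ x x ≡ 1
δ-refl x = cong 𝟙 (⌊⌋-true (x ≟ x) refl)

δ-≢ : ∀ {n} {x y : Fin n} → ¬ x ≡ y → δ x y ≡ 0
δ-≢ {x = x} {y} x≢y = cong 𝟙 (⌊⌋-false (x ≟ y) x≢y)

δ-sym : ∀ {n} (x y : Fin n) → δ x y ≡ δ y x
δ-sym x y with x ≟ y
... | yes refl = sym (δ-refl x)
... | no x≢y   = sym (δ-≢ (x≢y ∘ sym))

⌊suc≟suc⌋ : ∀ {n} (x y : Fin n) → ⌊ Fin.suc x ≟ suc y ⌋ ≡ ⌊ x ≟ y ⌋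
⌊suc≟suc⌋ x y with x ≟ y
... | yes _ = refl
... | no _  = refl

δ≤1 : ∀ {n} (x y : Fin n) → δ x y ≤ 1
δ≤1 x y = 𝟙≤1 ⌊ x ≟ y ⌋

δ-+-δ≤1+δ : ∀ {n} (x y z : Fin n) → δ x y + δ x z ≤ 1 + δ y z
δ-+-δ≤1+δ x y z with x ≟ y | x ≟ z
... | no _     | no _     = z≤n
... | yes _    | no _     = s≤s z≤n
... | no _     | yes _    = s≤s z≤n
... | yes refl | yes refl = ≤-reflexive (cong suc (sym (δ-refl x)))

∑-δ-* : ∀ {n} (x : Fin n) (f : Fin n → ℕ) → ∑[ i < n ] (δ i x * f i) ≡ f x
∑-δ-* {suc n} zero f =
  trans (cong (_+_ (1 * f zero)) (trans (sum-const n 0) (*-zeroʳ n)))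
        (trans (+-identityʳ _) (*-identityˡ _))
∑-δ-* {suc n} (suc x) f =
  trans (sum-cong-≗ λ i → cong (_* f (suc i)) (cong 𝟙 (⌊suc≟suc⌋ i x))) (∑-δ-* x (f ∘ suc))

∑-δ : ∀ {n} (x : Fin n) → ∑[ i < n ] δ x i ≡ 1
∑-δ x = trans (sum-cong-≗ λ i → trans (δ-sym x i) (sym (*-identityʳ _))) (∑-δ-* x (λ _ → 1))

fibreSize : ∀ {n m} → (Fin n → Fin m) → Fin m → ℕ
fibreSize {n} h ℓ = ∑[ j < n ] δ (h j) ℓ

∑-fibreSize : ∀ {n m} (h : Fin n → Fin m) → ∑[ ℓ < m ] fibreSize h ℓ ≡ n
∑-fibreSize {n} {m} h = begin
  ∑[ ℓ < m ] ∑[ j < n ] δ (h j) ℓ  ≡⟨ ∑-comm (λ ℓ j → δ (h j) ℓ) ⟩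
  ∑[ j < n ] ∑[ ℓ < m ] δ (h j) ℓ  ≡⟨ sum-cong-≗ (λ j → ∑-δ (h j)) ⟩
  ∑[ j < n ] 1                     ≡⟨ ∑-1 n ⟩
  n ∎
  where open ≡-Reasoning

fibreSize-+-fibreSize≤ : ∀ {n m} (h : Fin n → Fin m) {ℓ ℓ′ : Fin m} → ¬ ℓ ≡ ℓ′ →
                fibreSize h ℓ + fibreSize h ℓ′ ≤ n
fibreSize-+-fibreSize≤ {n} h {ℓ} {ℓ′} ℓ≢ℓ′ = begin
  fibreSize h ℓ + fibreSize h ℓ′       ≡⟨ ∑-distrib-+ (λ j → δ (h j) ℓ) (λ j → δ (h j) ℓ′) ⟨
  ∑[ j < n ] (δ (h j) ℓ + δ (h j) ℓ′)  ≤⟨ sum-mono-≤ (λ j → δ-+-δ≤1+δ (h j) ℓ ℓ′) ⟩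
  ∑[ j < n ] (1 + δ ℓ ℓ′)              ≡⟨ trans (sum-const n _) (cong (λ d → n * suc d) (δ-≢ ℓ≢ℓ′)) ⟩
  n * 1                                ≡⟨ *-identityʳ n ⟩
  n ∎
  where open ≤-Reasoning

anyFin-select : ∀ n (i : Fin n) (p : Fin n → Bool) → anyFin n (λ x → ⌊ x ≟ i ⌋ ∧ p x) ≡ p i
anyFin-select (suc n) zero p = trans (cong (_∨_ (p zero)) (none n)) (∨-identityʳ (p zero))
  where
  none : ∀ n → anyFin n (λ _ → false) ≡ false
  none zero    = refl
  none (suc n) = none n
anyFin-select (suc n) (suc i) p = trans (anyFin-cong n (λ x → cong (_∧ p (suc x)) (⌊suc≟suc⌋ x i)))
                                        (anyFin-select n i (p ∘ suc))
  where
  anyFin-cong : ∀ n {p q : Fin n → Bool} → (∀ i → p i ≡ q i) → anyFin n p ≡ anyFin n q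
  anyFin-cong zero    p≗q = refl
  anyFin-cong (suc n) p≗q = cong₂ _∨_ (p≗q zero) (anyFin-cong n (p≗q ∘ suc))

hasDiag-Row : ∀ {k} (i : Fin k) (S : Sub k) → hasDiag (Row i ∩ S) ≡ S (i , i)
hasDiag-Row {k} i S = anyFin-select k i (λ x → S (x , x))

hasDiag-Col : ∀ {k} (i : Fin k) (S : Sub k) → hasDiag (Col i ∩ S) ≡ S (i , i)
hasDiag-Col {k} i S = anyFin-select k i (λ x → S (x , x))

card≡∑∑ : ∀ {k} (S : Sub k) → card S ≡ ∑[ x < k ] ∑[ y < k ] 𝟙 (S (x , y))
card≡∑∑ {k} S = trans (Σℕ≡sum k _) (sum-cong-≗ (λ x → Σℕ≡sum k (λ y → 𝟙 (S (x , y)))))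

card-Row : ∀ {k} (i : Fin k) (S : Sub k) → card (Row i ∩ S) ≡ ∑[ y < k ] 𝟙 (S (i , y))
card-Row {k} i S = begin
  card (Row i ∩ S)
    ≡⟨ card≡∑∑ (Row i ∩ S) ⟩
  ∑[ x < k ] ∑[ y < k ] 𝟙 (⌊ x ≟ i ⌋ ∧ S (x , y))
    ≡⟨ sum-cong-≗ (λ x → sum-cong-≗ (λ y → 𝟙-∧ ⌊ x ≟ i ⌋ (S (x , y)))) ⟩
  ∑[ x < k ] ∑[ y < k ] (δ x i * 𝟙 (S (x , y)))
    ≡⟨ sum-cong-≗ (λ x → *-distribˡ-sum (δ x i) (λ y → 𝟙 (S (x , y)))) ⟨
  ∑[ x < k ] (δ x i * ∑[ y < k ] 𝟙 (S (x , y)))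
    ≡⟨ ∑-δ-* i (λ x → ∑[ y < k ] 𝟙 (S (x , y))) ⟩
  ∑[ y < k ] 𝟙 (S (i , y)) ∎
  where open ≡-Reasoning

card-Col : ∀ {k} (i : Fin k) (S : Sub k) → card (Col i ∩ S) ≡ ∑[ x < k ] 𝟙 (S (x , i))
card-Col {k} i S = begin
  card (Col i ∩ S)
    ≡⟨ card≡∑∑ (Col i ∩ S) ⟩
  ∑[ x < k ] ∑[ y < k ] 𝟙 (⌊ y ≟ i ⌋ ∧ S (x , y))
    ≡⟨ sum-cong-≗ (λ x → sum-cong-≗ (λ y → 𝟙-∧ ⌊ y ≟ i ⌋ (S (x , y)))) ⟩
  ∑[ x < k ] ∑[ y < k ] (δ y i * 𝟙 (S (x , y)))
    ≡⟨ sum-cong-≗ (λ x → ∑-δ-* i (λ y → 𝟙 (S (x , y)))) ⟩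
  ∑[ x < k ] 𝟙 (S (x , i)) ∎
  where open ≡-Reasoning

-- Rationals with denominator 8

eighths : ℕ → ℚ
eighths n = + n / 8

private
  toℚᵘ-eighths : ∀ n → toℚᵘ (eighths n) ≃ᵘ mkℚᵘ (+ n) 7
  toℚᵘ-eighths n = ℚ.toℚᵘ-fromℚᵘ (mkℚᵘ (+ n) 7)

  toℚᵘ-ℕtoℚ : ∀ n → toℚᵘ (ℕtoℚ n) ≃ᵘ mkℚᵘ (+ n) 0
  toℚᵘ-ℕtoℚ n = ℚ.toℚᵘ-fromℚᵘ (mkℚᵘ (+ n) 0)

  toℚᵘ-eighths⁻¹ : ∀ {p} n → toℚᵘ p ≃ᵘ mkℚᵘ (+ n) 7 → p ≡ eighths n
  toℚᵘ-eighths⁻¹ n p≃ = ℚ.toℚᵘ-injective (ℚᵘ.≃-trans p≃ (ℚᵘ.≃-sym (toℚᵘ-eighths n)))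

eighths-+ : ∀ a b → eighths a ℚ.+ eighths b ≡ eighths (a + b)
eighths-+ a b = toℚᵘ-eighths⁻¹ (a + b) (ℚᵘ.≃-trans (ℚ.toℚᵘ-homo-+ (eighths a) (eighths b))
  (ℚᵘ.≃-trans (ℚᵘ.+-cong (toℚᵘ-eighths a) (toℚᵘ-eighths b))
    (*≡* (trans (over-8 (+ a) (+ b)) (cong (ℤ._* + 64) (sym (ℤ.pos-+ a b)))))))
  where
  over-8 : ∀ x y → (x ℤ.* + 8 ℤ.+ y ℤ.* + 8) ℤ.* + 8 ≡ (x ℤ.+ y) ℤ.* + 64
  over-8 = ℤ-Solver.solve-∀

ℕtoℚ≡eighths : ∀ n → ℕtoℚ n ≡ eighths (8 * n)
ℕtoℚ≡eighths n = toℚᵘ-eighths⁻¹ (8 * n) (ℚᵘ.≃-trans (toℚᵘ-ℕtoℚ n)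
  (*≡* (trans (sym (ℤ.pos-* n 8))
    (trans (cong +_ (*-comm n 8)) (sym (ℤ.*-identityʳ (+ (8 * n))))))))

eighths-*-ℕtoℚ : ∀ a n → eighths a ℚ.* ℕtoℚ n ≡ eighths (a * n)
eighths-*-ℕtoℚ a n = toℚᵘ-eighths⁻¹ (a * n) (ℚᵘ.≃-trans (ℚ.toℚᵘ-homo-* (eighths a) (ℕtoℚ n))
  (ℚᵘ.≃-trans (ℚᵘ.*-cong (toℚᵘ-eighths a) (toℚᵘ-ℕtoℚ n))
    (*≡* (cong (ℤ._* + 8) (sym (ℤ.pos-* a n))))))

eighths-mono-≤ : ∀ {a b} → a ≤ b → eighths a ℚ.≤ eighths b
eighths-mono-≤ {a} {b} a≤b = ℚ.toℚᵘ-cancel-≤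
  (ℚᵘ.≤-respˡ-≃ (ℚᵘ.≃-sym (toℚᵘ-eighths a)) (ℚᵘ.≤-respʳ-≃ (ℚᵘ.≃-sym (toℚᵘ-eighths b))
    (*≤* (subst₂ ℤ._≤_ (ℤ.pos-* a 8) (ℤ.pos-* b 8) (+≤+ (*-monoˡ-≤ 8 a≤b))))))

eighths-∸-1 : ∀ a → 8 ≤ a → eighths a ℚ.- 1ℚ ≡ eighths (a ∸ 8)
eighths-∸-1 a 8≤a = begin
  eighths a ℚ.- 1ℚ                 ≡⟨ cong (λ x → eighths x ℚ.- 1ℚ) (m∸n+n≡m 8≤a) ⟨
  eighths (a ∸ 8 + 8) ℚ.- 1ℚ       ≡⟨ cong (ℚ._- 1ℚ) (eighths-+ (a ∸ 8) 8) ⟨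
  eighths (a ∸ 8) ℚ.+ 1ℚ ℚ.- 1ℚ    ≡⟨ ℚ.+-assoc (eighths (a ∸ 8)) 1ℚ (ℚ.- 1ℚ) ⟩
  eighths (a ∸ 8) ℚ.+ (1ℚ ℚ.- 1ℚ)  ≡⟨ cong (eighths (a ∸ 8) ℚ.+_) (ℚ.+-inverseʳ 1ℚ) ⟩
  eighths (a ∸ 8) ℚ.+ ℚ.0ℚ         ≡⟨ ℚ.+-identityʳ (eighths (a ∸ 8)) ⟩
  eighths (a ∸ 8) ∎
  where open ≡-Reasoning

quarter≤eighths-double : ∀ (z : ℤ) T → z ℤ.≤ + T → z / 4 ℚ.≤ eighths (2 * T)
quarter≤eighths-double z T z≤T = ℚ.toℚᵘ-cancel-≤
  (ℚᵘ.≤-respˡ-≃ (ℚᵘ.≃-sym (ℚ.toℚᵘ-fromℚᵘ (mkℚᵘ z 3))) (ℚᵘ.≤-respʳ-≃ (ℚᵘ.≃-sym (toℚᵘ-eighths (2 * T)))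
    (*≤* (subst (z ℤ.* + 8 ℤ.≤_) (trans (double-over (+ T)) (cong (ℤ._* + 4) (sym (ℤ.pos-* 2 T))))
      (ℤ.*-monoʳ-≤-nonNeg (+ 8) z≤T)))))
  where
  double-over : ∀ t → t ℤ.* + 8 ≡ (+ 2 ℤ.* t) ℤ.* + 4
  double-over = ℤ-Solver.solve-∀

Σℚ-eighths : ∀ n {F : Fin n → ℚ} (h : Fin n → ℕ) → (∀ i → F i ≡ eighths (h i)) → Σℚ n F ≡ eighths (sum h)
Σℚ-eighths zero    h F≗h = refl
Σℚ-eighths (suc n) h F≗h =
  trans (cong₂ ℚ._+_ (F≗h zero) (Σℚ-eighths n (h ∘ suc) (F≗h ∘ suc))) (eighths-+ (h zero) (sum (h ∘ suc)))

m≤o+[n+1]⇒m-n-1≤o : ∀ m n o → m ≤ o + (n + 1) → + m - + n - + 1 ℤ.≤ + o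
m≤o+[n+1]⇒m-n-1≤o m n o m≤ = begin
  + m - + n - + 1
    ≡⟨ regroup (+ m) (+ n) ⟩
  + m ℤ.+ ℤ.- (+ n ℤ.+ + 1)
    ≤⟨ ℤ.+-monoˡ-≤ (ℤ.- (+ n ℤ.+ + 1)) (subst (+ m ℤ.≤_) casts (+≤+ m≤)) ⟩
  + o ℤ.+ (+ n ℤ.+ + 1) ℤ.+ ℤ.- (+ n ℤ.+ + 1)
    ≡⟨ cancel (+ o) (+ n ℤ.+ + 1) ⟩
  + o ∎
  where
  open ℤ.≤-Reasoning
  regroup : ∀ x y → x - y - + 1 ≡ x ℤ.+ ℤ.- (y ℤ.+ + 1)
  regroup = ℤ-Solver.solve-∀
  cancel : ∀ x y → x ℤ.+ y ℤ.+ ℤ.- y ≡ x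
  cancel = ℤ-Solver.solve-∀
  casts : + (o + (n + 1)) ≡ + o ℤ.+ (+ n ℤ.+ + 1)
  casts = trans (ℤ.pos-+ o (n + 1)) (cong (ℤ._+_ (+ o)) (ℤ.pos-+ n 1))

eighths-⊓ : ∀ m n → eighths (m ⊓ n) ≡ eighths m ℚ.⊓ eighths n
eighths-⊓ m n with ≤-total m n
... | inj₁ m≤n = trans (cong eighths (m≤n⇒m⊓n≡m m≤n)) (sym (ℚ.p≤q⇒p⊓q≡p (eighths-mono-≤ m≤n)))
... | inj₂ n≤m = trans (cong eighths (m≥n⇒m⊓n≡n n≤m)) (sym (ℚ.p≥q⇒p⊓q≡q (eighths-mono-≤ n≤m)))

-- Eight times φn and φt; for φt this needs a ≥ 1 and k ≥ 3, where the term 3ka/8 is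
-- never the minimum.
φn⁸ : ℕ → ℕ → ℕ
φn⁸ k x = (8 * x) ⊓ (7 * k)

φt⁸ : ℕ → ℕ → ℕ
φt⁸ k x = (3 * k + 8 * x ∸ 8) ⊓ (7 * k)

φn≡eighths-φn⁸ : ∀ k x → φn k x ≡ eighths (φn⁸ k x)
φn≡eighths-φn⁸ k x = begin
  ℕtoℚ x ℚ.⊓ (eighths 7 ℚ.* ℕtoℚ k)    ≡⟨ cong₂ ℚ._⊓_ (ℕtoℚ≡eighths x) (eighths-*-ℕtoℚ 7 k) ⟩
  eighths (8 * x) ℚ.⊓ eighths (7 * k)  ≡⟨ eighths-⊓ (8 * x) (7 * k) ⟨
  eighths (φn⁸ k x) ∎
  where open ≡-Reasoning

3k+8a∸8≤3ka : ∀ {k a} → 3 ≤ k → 1 ≤ a → 3 * k + 8 * a ∸ 8 ≤ 3 * k * a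
3k+8a∸8≤3ka {k} {suc a} 3≤k _ = begin
  3 * k + 8 * suc a ∸ 8  ≡⟨ cong (_∸ 8) (shift k a) ⟩
  3 * k + 8 * a + 8 ∸ 8  ≡⟨ m+n∸n≡m (3 * k + 8 * a) 8 ⟩
  3 * k + 8 * a          ≤⟨ +-monoʳ-≤ (3 * k) (*-monoˡ-≤ a (≤-trans (n≤1+n 8) (*-monoʳ-≤ 3 3≤k))) ⟩
  3 * k + 3 * k * a      ≡⟨ *-suc (3 * k) a ⟨
  3 * k * suc a ∎
  where
  open ≤-Reasoning
  shift : ∀ k a → 3 * k + 8 * suc a ≡ 3 * k + 8 * a + 8
  shift = solve-∀

φt≡eighths-φt⁸ : ∀ {k a} → 3 ≤ k → 1 ≤ a → φt k a ≡ eighths (φt⁸ k a)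
φt≡eighths-φt⁸ {k} {a} 3≤k 1≤a = begin
  (eighths 3 ℚ.* ℕtoℚ k ℚ.* ℕtoℚ a) ℚ.⊓ (eighths 3 ℚ.* ℕtoℚ k ℚ.+ ℕtoℚ a ℚ.- 1ℚ) ℚ.⊓ (eighths 7 ℚ.* ℕtoℚ k)
    ≡⟨ cong₂ ℚ._⊓_ (cong₂ ℚ._⊓_ linear affine) (eighths-*-ℕtoℚ 7 k) ⟩
  eighths (3 * k * a) ℚ.⊓ eighths (3 * k + 8 * a ∸ 8) ℚ.⊓ eighths (7 * k)
    ≡⟨ cong (ℚ._⊓ eighths (7 * k)) (ℚ.p≥q⇒p⊓q≡q (eighths-mono-≤ (3k+8a∸8≤3ka 3≤k 1≤a))) ⟩
  eighths (3 * k + 8 * a ∸ 8) ℚ.⊓ eighths (7 * k)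
    ≡⟨ eighths-⊓ (3 * k + 8 * a ∸ 8) (7 * k) ⟨
  eighths (φt⁸ k a) ∎
  where
  open ≡-Reasoning
  linear : eighths 3 ℚ.* ℕtoℚ k ℚ.* ℕtoℚ a ≡ eighths (3 * k * a)
  linear = trans (cong (ℚ._* ℕtoℚ a) (eighths-*-ℕtoℚ 3 k)) (eighths-*-ℕtoℚ (3 * k) a)
  affine : eighths 3 ℚ.* ℕtoℚ k ℚ.+ ℕtoℚ a ℚ.- 1ℚ ≡ eighths (3 * k + 8 * a ∸ 8)
  affine = begin
    eighths 3 ℚ.* ℕtoℚ k ℚ.+ ℕtoℚ a ℚ.- 1ℚ
      ≡⟨ cong₂ (λ u v → u ℚ.+ v ℚ.- 1ℚ) (eighths-*-ℕtoℚ 3 k) (ℕtoℚ≡eighths a) ⟩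
    eighths (3 * k) ℚ.+ eighths (8 * a) ℚ.- 1ℚ
      ≡⟨ cong (ℚ._- 1ℚ) (eighths-+ (3 * k) (8 * a)) ⟩
    eighths (3 * k + 8 * a) ℚ.- 1ℚ
      ≡⟨ eighths-∸-1 (3 * k + 8 * a) (≤-trans (*-monoʳ-≤ 8 1≤a) (m≤n+m (8 * a) (3 * k))) ⟩
    eighths (3 * k + 8 * a ∸ 8) ∎

g⁸ : ℕ → Bool → ℕ → ℕ
g⁸ k d x = if d then φt⁸ k x else φn⁸ k x

4k+8≤7k : ∀ {k} → 3 ≤ k → 4 * k + 8 ≤ 7 * k
4k+8≤7k {k} 3≤k = begin
  4 * k + 8      ≤⟨ +-monoʳ-≤ (4 * k) (≤-trans (n≤1+n 8) (*-monoʳ-≤ 3 3≤k)) ⟩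
  4 * k + 3 * k  ≡⟨ *-distribʳ-+ k 4 3 ⟨
  7 * k ∎
  where open ≤-Reasoning

φt⁸-large : ∀ {k x} → 4 * k + 8 ≤ 8 * x → φt⁸ k x ≡ 7 * k
φt⁸-large {k} {x} 4k+8≤8x = m≥n⇒m⊓n≡n (m+n≤o⇒m≤o∸n (7 * k) (begin
  7 * k + 8            ≡⟨ split k ⟩
  3 * k + (4 * k + 8)  ≤⟨ +-monoʳ-≤ (3 * k) 4k+8≤8x ⟩
  3 * k + 8 * x ∎))
  where
  open ≤-Reasoning
  split : ∀ k → 7 * k + 8 ≡ 3 * k + (4 * k + 8)
  split = solve-∀

φt⁸-small : ∀ {k x} → 1 ≤ x → 8 * x ≤ 4 * k + 8 → φt⁸ k x + 8 ≡ 3 * k + 8 * x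
φt⁸-small {k} {x} 1≤x 8x≤4k+8 =
  trans (cong (_+ 8) (m≤n⇒m⊓n≡m below)) (m∸n+n≡m (≤-trans (*-monoʳ-≤ 8 1≤x) (m≤n+m (8 * x) (3 * k))))
  where
  split : ∀ k → 3 * k + (4 * k + 8) ≡ 8 + 7 * k
  split = solve-∀
  below : 3 * k + 8 * x ∸ 8 ≤ 7 * k
  below = m≤n+o⇒m∸n≤o (3 * k + 8 * x) 8 (≤-trans (+-monoʳ-≤ (3 * k) 8x≤4k+8) (≤-reflexive (split k)))

-- The value of one row

module RowProfile {k : ℕ} (j : Fin k) (b : Fin k → ℕ) (∑b≡k : sum b ≡ k)
                  (b-disjoint : ∀ {ℓ ℓ′} → ¬ ℓ ≡ ℓ′ → b ℓ + b ℓ′ ≤ k) where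

  rowValue : ℕ
  rowValue = ∑[ ℓ < k ] g⁸ k ⌊ j ≟ ℓ ⌋ (b ℓ)

  ∑8b≡8k : ∑[ ℓ < k ] (8 * b ℓ) ≡ 8 * k
  ∑8b≡8k = trans (sym (*-distribˡ-sum 8 b)) (cong (8 *_) ∑b≡k)

  8b≤7k-beside : ∀ {ℓ ℓ′} → ¬ ℓ ≡ ℓ′ → k ≤ 8 * b ℓ′ → 8 * b ℓ ≤ 7 * k
  8b≤7k-beside {ℓ} {ℓ′} ℓ≢ℓ′ k≤8bℓ′ = +-cancelʳ-≤ k (8 * b ℓ) (7 * k) (begin
    8 * b ℓ + k         ≤⟨ +-monoʳ-≤ (8 * b ℓ) k≤8bℓ′ ⟩
    8 * b ℓ + 8 * b ℓ′  ≡⟨ *-distribˡ-+ 8 (b ℓ) (b ℓ′) ⟨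
    8 * (b ℓ + b ℓ′)    ≤⟨ *-monoʳ-≤ 8 (b-disjoint ℓ≢ℓ′) ⟩
    8 * k               ≡⟨ +-comm k (7 * k) ⟩
    7 * k + k ∎)
    where open ≤-Reasoning

  ∑φn⁸-except : (x : Fin k) → (∀ ℓ → ¬ ℓ ≡ x → 8 * b ℓ ≤ 7 * k) →
                ∑[ ℓ < k ] φn⁸ k (b ℓ) + 8 * b x ≡ 8 * k + φn⁸ k (b x)
  ∑φn⁸-except x small = trans (sum-update x (λ ℓ ℓ≢x → m≤n⇒m⊓n≡m (small ℓ ℓ≢x)))
                              (cong (_+ φn⁸ k (b x)) ∑8b≡8k)

  ∑φn⁸-small : (∀ ℓ → 8 * b ℓ ≤ 7 * k) → ∑[ ℓ < k ] φn⁸ k (b ℓ) ≡ 8 * k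
  ∑φn⁸-small small = trans (sum-cong-≗ (λ ℓ → m≤n⇒m⊓n≡m (small ℓ))) ∑8b≡8k

  ∑φn⁸-large : ∀ {x} → 7 * k ≤ 8 * b x → ∑[ ℓ < k ] φn⁸ k (b ℓ) + 8 * b x ≡ 8 * k + 7 * k
  ∑φn⁸-large {x} 7k≤8bx = trans
    (∑φn⁸-except x (λ ℓ ℓ≢x → 8b≤7k-beside ℓ≢x (≤-trans (m≤n*m k 7) 7k≤8bx)))
    (cong (_+_ (8 * k)) (m≥n⇒m⊓n≡n 7k≤8bx))

  rowValue-+-φn⁸ : rowValue + φn⁸ k (b j) ≡ ∑[ ℓ < k ] φn⁸ k (b ℓ) + φt⁸ k (b j)
  rowValue-+-φn⁸ = trans
    (sum-update j (λ ℓ ℓ≢j → cong (λ d → g⁸ k d (b ℓ)) (⌊⌋-false (j ≟ ℓ) (ℓ≢j ∘ sym))))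
    (cong (λ d → ∑[ ℓ < k ] φn⁸ k (b ℓ) + g⁸ k d (b j)) (⌊⌋-true (j ≟ j) refl))

  module _ (3≤k : 3 ≤ k) where

    rowValue-top : 4 * k + 8 < 8 * b j → rowValue + 8 * b j ≡ 8 * k + 7 * k
    rowValue-top 4k+8<8bj = +-cancelʳ-≡ (φn⁸ k (b j)) _ _ (begin
      rowValue + 8 * b j + φn⁸ k (b j)
        ≡⟨ xy∙z≈xz∙y (rowValue) _ _ ⟩
      rowValue + φn⁸ k (b j) + 8 * b j
        ≡⟨ cong (_+ 8 * b j) rowValue-+-φn⁸ ⟩
      ∑φn⁸ + φt⁸ k (b j) + 8 * b j
        ≡⟨ cong (λ y → ∑φn⁸ + y + 8 * b j) (φt⁸-large {k} {b j} (<⇒≤ 4k+8<8bj)) ⟩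
      ∑φn⁸ + 7 * k + 8 * b j
        ≡⟨ xy∙z≈xz∙y ∑φn⁸ (7 * k) (8 * b j) ⟩
      ∑φn⁸ + 8 * b j + 7 * k
        ≡⟨ cong (_+ 7 * k) (∑φn⁸-except j small) ⟩
      8 * k + φn⁸ k (b j) + 7 * k
        ≡⟨ xy∙z≈xz∙y (8 * k) _ _ ⟩
      8 * k + 7 * k + φn⁸ k (b j) ∎)
      where
      open ≡-Reasoning
      ∑φn⁸ = ∑[ ℓ < k ] φn⁸ k (b ℓ)
      small : ∀ ℓ → ¬ ℓ ≡ j → 8 * b ℓ ≤ 7 * k
      small ℓ ℓ≢j = 8b≤7k-beside ℓ≢j (≤-trans (m≤n*m k 4) (≤-trans (m≤m+n (4 * k) 8) (<⇒≤ 4k+8<8bj)))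

    rowValue-low : 1 ≤ b j → 8 * b j ≤ 4 * k + 8 → rowValue + 8 ≡ 3 * k + ∑[ ℓ < k ] φn⁸ k (b ℓ)
    rowValue-low 1≤bj 8bj≤4k+8 = +-cancelʳ-≡ (φn⁸ k (b j)) _ _ (begin
      rowValue + 8 + φn⁸ k (b j)
        ≡⟨ xy∙z≈xz∙y (rowValue) _ _ ⟩
      rowValue + φn⁸ k (b j) + 8
        ≡⟨ cong (_+ 8) rowValue-+-φn⁸ ⟩
      ∑φn⁸ + φt⁸ k (b j) + 8
        ≡⟨ +-assoc ∑φn⁸ _ 8 ⟩
      ∑φn⁸ + (φt⁸ k (b j) + 8)
        ≡⟨ cong (_+_ ∑φn⁸) (φt⁸-small {k} 1≤bj 8bj≤4k+8) ⟩
      ∑φn⁸ + (3 * k + 8 * b j)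
        ≡⟨ cong (λ y → ∑φn⁸ + (3 * k + y)) (m≤n⇒m⊓n≡m (≤-trans 8bj≤4k+8 (4k+8≤7k 3≤k))) ⟨
      ∑φn⁸ + (3 * k + φn⁸ k (b j))
        ≡⟨ x∙yz≈yx∙z ∑φn⁸ (3 * k) _ ⟩
      3 * k + ∑φn⁸ + φn⁸ k (b j) ∎)
      where
      open ≡-Reasoning
      ∑φn⁸ = ∑[ ℓ < k ] φn⁸ k (b ℓ)

2mn≤m²+n² : ∀ m n → 2 * m * n ≤ m * m + n * n
2mn≤m²+n² m n =
  [ ordered , (λ n≤m → subst₂ _≤_ (swap n m) (+-comm (n * n) (m * m)) (ordered n≤m)) ]′ (≤-total m n)
  where
  expand : ∀ a d → a * a + (a + d) * (a + d) ≡ 2 * a * (a + d) + d * d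
  expand = solve-∀
  swap : ∀ a b → 2 * a * b ≡ 2 * b * a
  swap = solve-∀
  ordered : ∀ {a b} → a ≤ b → 2 * a * b ≤ a * a + b * b
  ordered {a} a≤b with m≤n⇒∃[o]m+o≡n a≤b
  ... | d , refl = subst (2 * a * (a + d) ≤_) (sym (expand a d)) (m≤m+n _ (d * d))

-- When k ≤ 8m the slack is (m − r)² + 10m + 6r + 1.
rowSum-slack : ∀ m r → let k = m + r in
  10 * k * k + (r * (8 * m ⊔ k + 8) + 4 * (m * m + m)) ≤ k * (11 * k) + 4 * k * m + (14 * k + 1)
rowSum-slack m r with ≤-total (8 * m) (m + r)
... | inj₁ 8m≤k rewrite m≤n⇒m⊔n≡n 8m≤k = begin
    L                                             ≤⟨ m≤m+n L _ ⟩
    L + (m * m + 5 * m * r + 10 * m + 6 * r + 1)  ≡⟨ expand m r ⟨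
    k * (11 * k) + 4 * k * m + (14 * k + 1) ∎
  where
  open ≤-Reasoning
  k = m + r
  L = 10 * k * k + (r * (k + 8) + 4 * (m * m + m))
  expand : ∀ m r → let k = m + r in
    k * (11 * k) + 4 * k * m + (14 * k + 1) ≡
    10 * k * k + (r * (k + 8) + 4 * (m * m + m)) + (m * m + 5 * m * r + 10 * m + 6 * r + 1)
  expand = solve-∀
... | inj₂ k≤8m rewrite m≥n⇒m⊔n≡m k≤8m =
  +-cancelʳ-≤ (2 * m * r) _ _ (begin
    L + 2 * m * r
      ≤⟨ +-monoʳ-≤ L (≤-trans (2mn≤m²+n² m r) (m≤m+n _ (10 * m + 6 * r + 1))) ⟩
    L + (m * m + r * r + (10 * m + 6 * r + 1))
      ≡⟨ expand m r ⟩
    k * (11 * k) + 4 * k * m + (14 * k + 1) + 2 * m * r ∎)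
  where
  open ≤-Reasoning
  k = m + r
  L = 10 * k * k + (r * (8 * m + 8) + 4 * (m * m + m))
  expand : ∀ m r → let k = m + r in
    10 * k * k + (r * (8 * m + 8) + 4 * (m * m + m)) + (m * m + r * r + (10 * m + 6 * r + 1)) ≡
    k * (11 * k) + 4 * k * m + (14 * k + 1) + 2 * m * r
  expand = solve-∀

rowSum-bound : ∀ {m r k} S → m + r ≡ k →
  k * (11 * k) + 4 * k * m ≤ S + (r * (8 * m ⊔ k + 8) + 4 * (m * m + m)) → 10 * k * k ≤ S + (14 * k + 1)
rowSum-bound {m} {r} S refl bound = +-cancelʳ-≤ X _ _ (begin
  10 * k * k + X                           ≤⟨ rowSum-slack m r ⟩
  k * (11 * k) + 4 * k * m + (14 * k + 1)  ≤⟨ +-monoˡ-≤ (14 * k + 1) bound ⟩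
  S + X + (14 * k + 1)                     ≡⟨ xy∙z≈xz∙y S X (14 * k + 1) ⟩
  S + (14 * k + 1) + X ∎)
  where
  open ≤-Reasoning
  k = m + r
  X = r * (8 * m ⊔ k + 8) + 4 * (m * m + m)

-- Symmetric labellings

module SymmetricLabelling {k : ℕ} (c : Cell k → Fin k)
  (c-sym : ∀ i j → c (i , j) ≡ c (j , i)) (c-diag : ∀ ℓ → c (ℓ , ℓ) ≡ ℓ) where

  rowCount : Fin k → Fin k → ℕ
  rowCount j = fibreSize (λ i → c (j , i))

  module Profile (j : Fin k) =
    RowProfile j (rowCount j) (∑-fibreSize (λ i → c (j , i))) (fibreSize-+-fibreSize≤ (λ i → c (j , i)))

  1≤rowCount-diag : ∀ j → 1 ≤ rowCount j j
  1≤rowCount-diag j = subst (_≤ rowCount j j) (trans (cong (λ x → δ x j) (c-diag j)) (δ-refl j))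
                            (term≤sum (λ i → δ (c (j , i)) j) j)

  hits : (Fin k → ℕ) → Fin k → ℕ
  hits w j = ∑[ i < k ] (w i * δ (c (j , i)) i)

  ∑-hits : ∀ w → ∑[ j < k ] hits w j ≡ ∑[ i < k ] (w i * rowCount i i)
  ∑-hits w = begin
    ∑[ j < k ] ∑[ i < k ] (w i * δ (c (j , i)) i)
      ≡⟨ ∑-comm (λ j i → w i * δ (c (j , i)) i) ⟩
    ∑[ i < k ] ∑[ j < k ] (w i * δ (c (j , i)) i)
      ≡⟨ sum-cong-≗ (λ i → sym (*-distribˡ-sum (w i) (λ j → δ (c (j , i)) i))) ⟩
    ∑[ i < k ] (w i * ∑[ j < k ] δ (c (j , i)) i)
      ≡⟨ sum-cong-≗ (λ i → cong (_*_ (w i)) (sum-cong-≗ (λ j → cong (λ x → δ x i) (c-sym j i)))) ⟩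
    ∑[ i < k ] (w i * rowCount i i) ∎
    where open ≡-Reasoning

  hits≤∑ : ∀ w j → hits w j ≤ sum w
  hits≤∑ w j =
    sum-mono-≤ (λ i → ≤-trans (*-monoʳ-≤ (w i) (δ≤1 (c (j , i)) i)) (≤-reflexive (*-identityʳ (w i))))

  -- The extra δ j i makes room for i = ℓ, which may be counted twice; i = j is counted by neither.
  hits-+-rowCount≤k : ∀ {w} → (∀ i → w i ≤ 1) → ∀ {j ℓ} → w j ≡ 0 → ¬ j ≡ ℓ →
                      hits w j + rowCount j ℓ ≤ k
  hits-+-rowCount≤k {w} w≤1 {j} {ℓ} wj≡0 j≢ℓ = +-cancelʳ-≤ 1 _ _ (begin
    hits w j + rowCount j ℓ + 1
      ≡⟨ cong₂ _+_ (∑-distrib-+ (λ i → w i * δ (c (j , i)) i) (λ i → δ (c (j , i)) ℓ)) (∑-δ j) ⟨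
    ∑[ i < k ] (w i * δ (c (j , i)) i + δ (c (j , i)) ℓ) + ∑[ i < k ] δ j i
      ≡⟨ ∑-distrib-+ (λ i → w i * δ (c (j , i)) i + δ (c (j , i)) ℓ) (δ j) ⟨
    ∑[ i < k ] (w i * δ (c (j , i)) i + δ (c (j , i)) ℓ + δ j i)
      ≤⟨ sum-mono-≤ cell ⟩
    ∑[ i < k ] (1 + δ ℓ i)
      ≡⟨ ∑-distrib-+ (λ _ → 1) (δ ℓ) ⟩
    ∑[ i < k ] 1 + ∑[ i < k ] δ ℓ i
      ≡⟨ cong₂ _+_ (∑-1 k) (∑-δ ℓ) ⟩
    k + 1 ∎)
    where
    open ≤-Reasoning
    cell : ∀ i → w i * δ (c (j , i)) i + δ (c (j , i)) ℓ + δ j i ≤ 1 + δ ℓ i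
    cell i with j ≟ i
    ... | yes refl rewrite wj≡0 | c-diag j | δ-≢ j≢ℓ = s≤s z≤n
    ... | no _ = begin
      w i * δ x i + δ x ℓ + 0
        ≡⟨ +-identityʳ _ ⟩
      w i * δ x i + δ x ℓ
        ≤⟨ +-monoˡ-≤ (δ x ℓ) (≤-trans (*-monoˡ-≤ (δ x i) (w≤1 i)) (≤-reflexive (+-identityʳ (δ x i)))) ⟩
      δ x i + δ x ℓ
        ≤⟨ δ-+-δ≤1+δ x i ℓ ⟩
      1 + δ i ℓ
        ≡⟨ cong suc (δ-sym i ℓ) ⟩
      1 + δ ℓ i ∎
      where x = c (j , i)

  2∑w*hits≤∑w²+∑w : ∀ {w} → (∀ i → w i ≤ 1) →
                      2 * ∑[ j < k ] (w j * hits w j) ≤ sum w * sum w + sum w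
  2∑w*hits≤∑w²+∑w {w} w≤1 = begin
    2 * W
      ≡⟨ cong (_+_ W) (+-identityʳ W) ⟩
    W + W
      ≡⟨ cong₂ _+_ W≡∑∑F (trans W≡∑∑F (∑-comm F)) ⟩
    ∑[ j < k ] ∑[ i < k ] F j i + ∑[ j < k ] ∑[ i < k ] F i j
      ≡⟨ ∑-distrib-+ (λ j → ∑[ i < k ] F j i) (λ j → ∑[ i < k ] F i j) ⟨
    ∑[ j < k ] (∑[ i < k ] F j i + ∑[ i < k ] F i j)
      ≡⟨ sum-cong-≗ (λ j → sym (∑-distrib-+ (F j) (λ i → F i j))) ⟩
    ∑[ j < k ] ∑[ i < k ] (F j i + F i j)
      ≤⟨ sum-mono-≤ (λ j → sum-mono-≤ (λ i → F-pair j i)) ⟩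
    ∑[ j < k ] ∑[ i < k ] (w j * w i + w j * δ i j)
      ≡⟨ sum-cong-≗ (λ j → row j) ⟩
    ∑[ j < k ] (sum w * w j + w j)
      ≡⟨ ∑-distrib-+ _ w ⟩
    ∑[ j < k ] (sum w * w j) + sum w
      ≡⟨ cong (_+ sum w) (*-distribˡ-sum (sum w) w) ⟨
    sum w * sum w + sum w ∎
    where
    open ≤-Reasoning
    W = ∑[ j < k ] (w j * hits w j)
    F : Fin k → Fin k → ℕ
    F j i = w j * (w i * δ (c (j , i)) i)
    W≡∑∑F : W ≡ ∑[ j < k ] ∑[ i < k ] F j i
    W≡∑∑F = sum-cong-≗ (λ j → *-distribˡ-sum (w j) (λ i → w i * δ (c (j , i)) i))
    F-pair : ∀ j i → F j i + F i j ≤ w j * w i + w j * δ i j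
    F-pair j i rewrite c-sym i j = begin
      w j * (w i * δ x i) + w i * (w j * δ x j)
        ≡⟨ factor (w j) (w i) (δ x i) (δ x j) ⟩
      w j * w i * (δ x i + δ x j)
        ≤⟨ *-monoʳ-≤ (w j * w i) (δ-+-δ≤1+δ x i j) ⟩
      w j * w i * (1 + δ i j)
        ≡⟨ *-distribˡ-+ (w j * w i) 1 (δ i j) ⟩
      w j * w i * 1 + w j * w i * δ i j
        ≤⟨ +-mono-≤ (≤-reflexive (*-identityʳ _)) (*-monoˡ-≤ (δ i j) w*wi≤w) ⟩
      w j * w i + w j * δ i j ∎
      where
      x = c (j , i)
      factor : ∀ a b p q → a * (b * p) + b * (a * q) ≡ a * b * (p + q)
      factor = solve-∀
      w*wi≤w : w j * w i ≤ w j
      w*wi≤w = ≤-trans (*-monoʳ-≤ (w j) (w≤1 i)) (≤-reflexive (*-identityʳ (w j)))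
    row : ∀ j → ∑[ i < k ] (w j * w i + w j * δ i j) ≡ sum w * w j + w j
    row j = begin-equality
      ∑[ i < k ] (w j * w i + w j * δ i j)
        ≡⟨ ∑-distrib-+ (λ i → w j * w i) (λ i → w j * δ i j) ⟩
      ∑[ i < k ] (w j * w i) + ∑[ i < k ] (w j * δ i j)
        ≡⟨ cong₂ _+_ (*-distribˡ-sum (w j) w) (*-distribˡ-sum (w j) (λ i → δ i j)) ⟨
      w j * sum w + w j * ∑[ i < k ] δ i j
        ≡⟨ cong₂ _+_ (*-comm (w j) (sum w)) (trans (cong (_*_ (w j)) ∑δ≡1) (*-identityʳ (w j))) ⟩
      sum w * w j + w j ∎
      where
      ∑δ≡1 : ∑[ i < k ] δ i j ≡ 1
      ∑δ≡1 = trans (sum-cong-≗ (λ i → δ-sym i j)) (∑-δ j)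

  module _ (3≤k : 3 ≤ k) where

    isTop : Fin k → Bool
    isTop j = ⌊ 4 * k + 8 <? 8 * rowCount j j ⌋

    top nonTop : Fin k → ℕ
    top j = 𝟙 (isTop j)
    nonTop j = 𝟙 (not (isTop j))

    top≤1 : ∀ j → top j ≤ 1
    top≤1 j = 𝟙≤1 (isTop j)

    m r M : ℕ
    m = sum top
    r = sum nonTop
    M = 8 * m ⊔ k

    m+r≡k : m + r ≡ k
    m+r≡k = begin
      m + r                          ≡⟨ ∑-distrib-+ top nonTop ⟨
      ∑[ j < k ] (top j + nonTop j)  ≡⟨ sum-cong-≗ (λ j → 𝟙-+-𝟙-not (isTop j)) ⟩
      ∑[ j < k ] 1                   ≡⟨ ∑-1 k ⟩
      k ∎
      where open ≡-Reasoning

    rowValue : Fin k → ℕ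
    rowValue j = Profile.rowValue j

    nonTop-large-rowBound : ∀ {j ℓ} → ¬ (4 * k + 8 < 8 * rowCount j j) → 7 * k < 8 * rowCount j ℓ →
                            11 * k + 8 * hits top j ≤ rowValue j + 8 + M
    nonTop-large-rowBound {j} {ℓ} low large = +-cancelʳ-≤ (8 * rowCount j ℓ) _ _ (begin
      11 * k + 8 * hits top j + 8 * rowCount j ℓ
        ≡⟨ +-assoc (11 * k) _ _ ⟩
      11 * k + (8 * hits top j + 8 * rowCount j ℓ)
        ≡⟨ cong (_+_ (11 * k)) (*-distribˡ-+ 8 (hits top j) _) ⟨
      11 * k + 8 * (hits top j + rowCount j ℓ)
        ≤⟨ +-monoʳ-≤ (11 * k) (*-monoʳ-≤ 8 (hits-+-rowCount≤k top≤1 top-j≡0 j≢ℓ)) ⟩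
      11 * k + 8 * k
        ≡⟨ regroup k ⟩
      3 * k + (8 * k + 7 * k) + k
        ≤⟨ +-mono-≤ (≤-reflexive (cong (_+_ (3 * k)) (sym (Profile.∑φn⁸-large j (<⇒≤ large))))) (m≤n⊔m (8 * m) k) ⟩
      3 * k + (∑φn⁸ + 8 * rowCount j ℓ) + M
        ≡⟨ cong (_+ M) (sym (+-assoc (3 * k) ∑φn⁸ _)) ⟩
      3 * k + ∑φn⁸ + 8 * rowCount j ℓ + M
        ≡⟨ cong (λ x → x + 8 * rowCount j ℓ + M) (Profile.rowValue-low j 3≤k (1≤rowCount-diag j) (≮⇒≥ low)) ⟨
      rowValue j + 8 + 8 * rowCount j ℓ + M
        ≡⟨ xy∙z≈xz∙y (rowValue j + 8) _ M ⟩
      rowValue j + 8 + M + 8 * rowCount j ℓ ∎)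
      where
      open ≤-Reasoning
      ∑φn⁸ = ∑[ ℓ′ < k ] φn⁸ k (rowCount j ℓ′)
      regroup : ∀ k → 11 * k + 8 * k ≡ 3 * k + (8 * k + 7 * k) + k
      regroup = solve-∀
      top-j≡0 : top j ≡ 0
      top-j≡0 = cong 𝟙 (⌊⌋-false (4 * k + 8 <? 8 * rowCount j j) low)
      j≢ℓ : ¬ j ≡ ℓ
      j≢ℓ refl = <⇒≱ large (≤-trans (≮⇒≥ low) (4k+8≤7k 3≤k))

    nonTop-small-rowBound : ∀ {j} → ¬ (4 * k + 8 < 8 * rowCount j j) → (∀ ℓ → 8 * rowCount j ℓ ≤ 7 * k) →
                            11 * k + 8 * hits top j ≤ rowValue j + 8 + M
    nonTop-small-rowBound {j} low all-small = begin
      11 * k + 8 * hits top j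
        ≤⟨ +-monoʳ-≤ (11 * k) (≤-trans (*-monoʳ-≤ 8 (hits≤∑ top j)) (m≤m⊔n (8 * m) k)) ⟩
      11 * k + M
        ≡⟨ cong (_+ M) (*-distribʳ-+ k 3 8) ⟩
      3 * k + 8 * k + M
        ≡⟨ cong (λ x → 3 * k + x + M) (Profile.∑φn⁸-small j all-small) ⟨
      3 * k + ∑[ ℓ < k ] φn⁸ k (rowCount j ℓ) + M
        ≡⟨ cong (_+ M) (Profile.rowValue-low j 3≤k (1≤rowCount-diag j) (≮⇒≥ low)) ⟨
      rowValue j + 8 + M ∎
      where open ≤-Reasoning

    nonTop-rowBound : ∀ j → ¬ (4 * k + 8 < 8 * rowCount j j) → 11 * k + 8 * hits top j ≤ rowValue j + 8 + M
    nonTop-rowBound j low with any? (λ ℓ → 7 * k <? 8 * rowCount j ℓ)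
    ... | yes (_ , large) = nonTop-large-rowBound low large
    ... | no no-large     = nonTop-small-rowBound low (λ ℓ → ≮⇒≥ (λ large → no-large (ℓ , large)))

    rowBound : ∀ j → 11 * k + 4 * k * top j + 8 * hits top j ≤
                     rowValue j + 8 * (top j * rowCount j j) + nonTop j * (M + 8) + 8 * (top j * hits top j)
    rowBound j = by-cases (4 * k + 8 <? 8 * rowCount j j)
      where
      open ≤-Reasoning
      a = rowCount j j
      h = hits top j
      by-cases : (d : Dec (4 * k + 8 < 8 * a)) →
        11 * k + 4 * k * 𝟙 ⌊ d ⌋ + 8 * h ≤
        rowValue j + 8 * (𝟙 ⌊ d ⌋ * a) + 𝟙 (not ⌊ d ⌋) * (M + 8) + 8 * (𝟙 ⌊ d ⌋ * h)
      by-cases (yes high) = begin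
        11 * k + 4 * k * 1 + 8 * h  ≡⟨ lhs k h ⟩
        8 * k + 7 * k + 8 * h       ≡⟨ cong (_+ 8 * h) (Profile.rowValue-top j 3≤k high) ⟨
        rowValue j + 8 * a + 8 * h  ≡⟨ rhs (rowValue j) a (M + 8) h ⟩
        rowValue j + 8 * (1 * a) + 0 * (M + 8) + 8 * (1 * h) ∎
        where
        lhs : ∀ k h → 11 * k + 4 * k * 1 + 8 * h ≡ 8 * k + 7 * k + 8 * h
        lhs = solve-∀
        rhs : ∀ v a M h → v + 8 * a + 8 * h ≡ v + 8 * (1 * a) + 0 * M + 8 * (1 * h)
        rhs = solve-∀
      by-cases (no low) = begin
        11 * k + 4 * k * 0 + 8 * h  ≡⟨ lhs k h ⟩
        11 * k + 8 * h              ≤⟨ nonTop-rowBound j low ⟩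
        rowValue j + 8 + M          ≡⟨ rhs (rowValue j) a M h ⟩
        rowValue j + 8 * (0 * a) + 1 * (M + 8) + 8 * (0 * h) ∎
        where
        lhs : ∀ k h → 11 * k + 4 * k * 0 + 8 * h ≡ 11 * k + 8 * h
        lhs = solve-∀
        rhs : ∀ v a M h → v + 8 + M ≡ v + 8 * (0 * a) + 1 * (M + 8) + 8 * (0 * h)
        rhs = solve-∀

    ∑rowValue-bound : k * (11 * k) + 4 * k * m ≤ ∑[ j < k ] rowValue j + (r * (M + 8) + 4 * (m * m + m))
    ∑rowValue-bound = +-cancelʳ-≤ (8 * A) _ _ (begin
      k * (11 * k) + 4 * k * m + 8 * A
        ≡⟨ cong (λ x → k * (11 * k) + 4 * k * m + 8 * x) (∑-hits top) ⟨
      k * (11 * k) + 4 * k * m + 8 * ∑[ j < k ] h j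
        ≡⟨ ∑lhs ⟨
      ∑[ j < k ] (11 * k + 4 * k * top j + 8 * h j)
        ≤⟨ sum-mono-≤ rowBound ⟩
      ∑[ j < k ] (rowValue j + 8 * (top j * rowCount j j) + nonTop j * (M + 8) + 8 * (top j * h j))
        ≡⟨ ∑rhs ⟩
      V + 8 * A + r * (M + 8) + 8 * W
        ≤⟨ +-monoʳ-≤ (V + 8 * A + r * (M + 8)) 8W≤ ⟩
      V + 8 * A + r * (M + 8) + 4 * (m * m + m)
        ≡⟨ regroup V (8 * A) (r * (M + 8)) (4 * (m * m + m)) ⟩
      V + (r * (M + 8) + 4 * (m * m + m)) + 8 * A ∎)
      where
      open ≤-Reasoning
      h = hits top
      A = ∑[ i < k ] (top i * rowCount i i)
      V = ∑[ j < k ] rowValue j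
      W = ∑[ j < k ] (top j * h j)
      ∑lhs : ∑[ j < k ] (11 * k + 4 * k * top j + 8 * h j) ≡ k * (11 * k) + 4 * k * m + 8 * ∑[ j < k ] h j
      ∑lhs = trans (∑-distrib-+₃ (λ _ → 11 * k) (λ j → 4 * k * top j) (λ j → 8 * h j))
                   (sym (cong₂ _+_ (cong₂ _+_ (sym (sum-const k (11 * k))) (*-distribˡ-sum (4 * k) top))
                                   (*-distribˡ-sum 8 h)))
      ∑rhs : ∑[ j < k ] (rowValue j + 8 * (top j * rowCount j j) + nonTop j * (M + 8) + 8 * (top j * h j)) ≡
             V + 8 * A + r * (M + 8) + 8 * W
      ∑rhs = trans (∑-distrib-+₃ (λ j → rowValue j + 8 * (top j * rowCount j j)) (λ j → nonTop j * (M + 8))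
                                  (λ j → 8 * (top j * h j)))
                   (cong₂ _+_ (cong₂ _+_ (trans (∑-distrib-+ rowValue (λ j → 8 * (top j * rowCount j j)))
                                                (cong (_+_ V) (sym (*-distribˡ-sum 8 (λ j → top j * rowCount j j)))))
                                         (sym (*-distribʳ-sum (M + 8) nonTop)))
                              (sym (*-distribˡ-sum 8 (λ j → top j * h j))))
      8W≤ : 8 * W ≤ 4 * (m * m + m)
      8W≤ = begin
        8 * W        ≡⟨ *-assoc 4 2 W ⟩
        4 * (2 * W)  ≤⟨ *-monoʳ-≤ 4 (2∑w*hits≤∑w²+∑w top≤1) ⟩
        4 * (m * m + m) ∎
      regroup : ∀ v a x y → v + a + x + y ≡ v + (x + y) + a
      regroup = solve-∀

    10k²≤∑rowValue : 10 * k * k ≤ ∑[ j < k ] rowValue j + (14 * k + 1)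
    10k²≤∑rowValue = rowSum-bound (∑[ j < k ] rowValue j) m+r≡k ∑rowValue-bound

    g-cell≡eighths-g⁸ : ∀ i ℓ → (if ⌊ i ≟ ℓ ⌋ then φt k (rowCount i ℓ) else φn k (rowCount i ℓ)) ≡
                              eighths (g⁸ k ⌊ i ≟ ℓ ⌋ (rowCount i ℓ))
    g-cell≡eighths-g⁸ i ℓ with i ≟ ℓ
    ... | yes refl = φt≡eighths-φt⁸ 3≤k (1≤rowCount-diag i)
    ... | no _     = φn≡eighths-φn⁸ k (rowCount i ℓ)

    Part-diag : ∀ i ℓ → Part c ℓ (i , i) ≡ ⌊ i ≟ ℓ ⌋
    Part-diag i ℓ = cong (λ x → ⌊ x ≟ ℓ ⌋) (c-diag i)

    g-Row : ∀ i ℓ → g (Row i ∩ Part c ℓ) ≡ eighths (g⁸ k ⌊ i ≟ ℓ ⌋ (rowCount i ℓ))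
    g-Row i ℓ = trans (cong₂ (λ d x → if d then φt k x else φn k x)
                             (trans (hasDiag-Row i (Part c ℓ)) (Part-diag i ℓ)) (card-Row i (Part c ℓ)))
                      (g-cell≡eighths-g⁸ i ℓ)

    g-Col : ∀ i ℓ → g (Col i ∩ Part c ℓ) ≡ eighths (g⁸ k ⌊ i ≟ ℓ ⌋ (rowCount i ℓ))
    g-Col i ℓ = trans (cong₂ (λ d x → if d then φt k x else φn k x)
                             (trans (hasDiag-Col i (Part c ℓ)) (Part-diag i ℓ))
                             (trans (card-Col i (Part c ℓ)) (sum-cong-≗ (λ x → cong (λ y → δ y ℓ) (c-sym x i)))))
                      (g-cell≡eighths-g⁸ i ℓ)

    ∑f≡eighths : Σℚ k (λ ℓ → f (Part c ℓ)) ≡ eighths (2 * ∑[ j < k ] rowValue j)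
    ∑f≡eighths = trans
      (Σℚ-eighths k (λ ℓ → ∑[ i < k ] (G i ℓ + G i ℓ))
        (λ ℓ → Σℚ-eighths k (λ i → G i ℓ + G i ℓ)
                 (λ i → trans (cong₂ ℚ._+_ (g-Row i ℓ) (g-Col i ℓ)) (eighths-+ (G i ℓ) (G i ℓ)))))
      (cong eighths ∑∑G≡2V)
      where
      G : Fin k → Fin k → ℕ
      G i ℓ = g⁸ k ⌊ i ≟ ℓ ⌋ (rowCount i ℓ)
      V = ∑[ j < k ] rowValue j
      ∑∑G≡2V : ∑[ ℓ < k ] ∑[ i < k ] (G i ℓ + G i ℓ) ≡ 2 * V
      ∑∑G≡2V = begin
        ∑[ ℓ < k ] ∑[ i < k ] (G i ℓ + G i ℓ)  ≡⟨ ∑-comm (λ ℓ i → G i ℓ + G i ℓ) ⟩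
        ∑[ i < k ] ∑[ ℓ < k ] (G i ℓ + G i ℓ)  ≡⟨ sum-cong-≗ (λ i → ∑-distrib-+ (G i) (G i)) ⟩
        ∑[ i < k ] (rowValue i + rowValue i)   ≡⟨ ∑-distrib-+ rowValue rowValue ⟩
        V + V                                  ≡⟨ cong (_+_ V) (+-identityʳ V) ⟨
        2 * V ∎
        where open ≡-Reasoning

lemma2p9 : (k : ℕ) → 4 ≤ k → (c : Cell k → Fin k) → IsSymMultiwayPartition c →
    ((+ (10 ℕ.* k ℕ.* k) - + (14 ℕ.* k) - + 1) / 4) ℚ.≤ Σℚ k (λ ℓ → f (Part c ℓ))
lemma2p9 k 4≤k c (c-sym , c-diag) = begin
  (+ (10 * k * k) - + (14 * k) - + 1) / 4
    ≤⟨ quarter≤eighths-double _ V (m≤o+[n+1]⇒m-n-1≤o _ _ V (10k²≤∑rowValue 3≤k)) ⟩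
  eighths (2 * V)
    ≡⟨ ∑f≡eighths 3≤k ⟨
  Σℚ k (λ ℓ → f (Part c ℓ)) ∎
  where
  open SymmetricLabelling c c-sym c-diag
  open ℚ.≤-Reasoning
  3≤k = ≤-trans (n≤1+n 3) 4≤k
  V = ∑[ j < k ] rowValue 3≤k j
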